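{- Let $(\beta,\lessdot)$ be a prioritized Bundle Event Structure with $\beta=(E,\#,\mapsto,l)$, let $\langle C,\preceq_C,l|_C\rangle\in\mathrm{lposets}(\beta)$, and let $\lessdot'=\lessdot\setminus\{(e,e')\mid e'\preceq_C e\vee e\preceq_C e'\}$. Then $\mathrm{Traces}(\beta,\lessdot)|_C=\mathrm{Traces}(\beta,\lessdot')|_C$.
   Context: A Bundle Event Structure (BES) is a quadruple $\beta=(E,\#,\mapsto,l)$ where $E$ is a set of events, $\#\subseteq E\times E$ is an irreflexive symmetric relation (conflict), $\mapsto\subseteq\mathcal{P}(E)\times E$ is the enabling relation (a pair $(X,e)$ is written $X\mapsto e$), and $l:E\to Act$ is a labeling function, satisfying Stability: whenever $X\mapsto e$, any two distinct $e_1,e_2\in X$ satisfy $e_1\# e_2$. For a finite sequence $\sigma=e_1\cdots e_n$ of events write $\bar\sigma=\{e_1,\dots,e_n\}$ and $\sigma_i=e_1\cdots e_i$ ($\sigma_0$ empty). Define $\mathrm{en}_\beta(\sigma)=\{e\in E\setminus\bar\sigma\mid (\forall X\subseteq E.\ X\mapsto e\Rightarrow X\cap\bar\sigma\neq\emptyset)\wedge\neg\exists e'\in\bar\sigma.\ e\# e'\}$. $\sigma$ is a trace of $\beta$ iff $e_i\in\mathrm{en}_\beta(\sigma_{i-1})$ for all $1\le i\le n$. A set $C\subseteq E$ is a configuration of $\beta$ iff $C=\bar\sigma$ for some trace $\sigma$ of $\beta$. For a configuration $C$, define $\prec_C\subseteq C\times C$ by $e\prec_C e'$ iff $\exists X\subseteq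 E.\ e\in X\wedge X\mapsto e'$, and let $\preceq_C$ be the reflexive and transitive closure of $\prec_C$ on $C$. $\mathrm{lposets}(\beta)$ is the set of triples $\langle C,\preceq_C,l|_C\rangle$ for all configurations $C$ of $\beta$. A prioritized BES (PBES) is a pair $(\beta,\lessdot)$ with $\lessdot\subseteq E\times E$ acyclic ($e\lessdot e'$: $e'$ has higher priority). $\sigma=e_1\cdots e_n$ is a trace of $(\beta,\lessdot)$ iff $\sigma$ is a trace of $\beta$ and for all $0\le i<n$ and all $e_j,e_h\in\bar\sigma$ with $e_j\neq e_h$, $e_j,e_h\in\mathrm{en}_\beta(\sigma_i)$ and $e_h\lessdot e_j$, we have $j<h$; $\mathrm{Traces}(\beta,\lessdot)$ is the set of these traces (same for subrelations of $\lessdot$), and $\mathrm{Traces}(\beta,\lessdot)|_C=\{\sigma\in\mathrm{Traces}(\beta,\lessdot)\mid\bar\sigma=C\}$. -}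

module Defs where

open import Data.Nat using (ℕ; _<_)
open import Data.Fin using (Fin; toℕ)
open import Data.List using (List; length; lookup; take)
open import Data.List.Membership.Propositional using (_∈_; _∉_)
open import Data.Product using (Σ; ∃; _×_; _,_)
open import Data.Sum using (_⊎_)
open import Relation.Nullary using (¬_)
open import Relation.Binary.PropositionalEquality using (_≡_; _≢_)
open import Relation.Binary.Construct.Closure.Transitive using (TransClosure)
open import Relation.Binary.Construct.Closure.ReflexiveTransitive using (Star)
open import Function.Bundles using (_⇔_)

record BES (Act : Set) : Set₁ where
  field
    E     : Set
    _#_   : E → E → Set
    _↦_   : (E → Set) → E → Set
    l     : E → Act
    #-irrefl : ∀ e → ¬ (e # e)
    #-sym    : ∀ e e' → e # e' → e' # e
    stability : ∀ X e → X ↦ e → ∀ e₁ e₂ → X e₁ → X e₂ → e₁ ≢ e₂ → e₁ # e₂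

module _ {Act : Set} (β : BES Act) where
  open BES β

  -- the underlying set of a finite sequence, σ̄, is membership in the list

  en : List E → E → Set₁
  en σ e = (e ∉ σ)
         × (∀ (X : E → Set) → X ↦ e → ∃ λ x → X x × x ∈ σ)
         × ¬ (∃ λ e' → e' ∈ σ × e # e')

  -- σ is a trace of β: e_i ∈ en(σ_{i-1}) (0-based: lookup σ i ∈ en (take i σ))
  IsTrace : List E → Set₁
  IsTrace σ = ∀ (i : Fin (length σ)) → en (take (toℕ i) σ) (lookup σ i)

  HasSet : List E → (E → Set) → Set
  HasSet σ C = ∀ e → (C e ⇔ e ∈ σ)

  IsConfiguration : (E → Set) → Set₁
  IsConfiguration C = ∃ λ σ → IsTrace σ × HasSet σ C

  ≺[_] : (E → Set) → E → E → Set₁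
  ≺[ C ] e e' = C e × C e' × ∃ λ (X : E → Set) → X e × X ↦ e'

  ⪯[_] : (E → Set) → E → E → Set₁
  ⪯[ C ] e e' = C e × C e' × Star ≺[ C ] e e'

  Acyclic : (E → E → Set₁) → Set₁
  Acyclic R = ∀ e → ¬ TransClosure R e e

  -- σ is a trace of (β, R) for a priority relation R (R e e' : e' has higher priority)
  IsPTrace : (E → E → Set₁) → List E → Set₁
  IsPTrace R σ = IsTrace σ ×
    (∀ (i : ℕ) → i < length σ → ∀ (j h : Fin (length σ)) →
       lookup σ j ≢ lookup σ h →
       en (take i σ) (lookup σ j) → en (take i σ) (lookup σ h) →
       R (lookup σ h) (lookup σ j) → toℕ j < toℕ h)

  InTracesRestr : (E → E → Set₁) → (E → Set) → List E → Set₁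
  InTracesRestr R C σ = IsPTrace R σ × HasSet σ C

  restrictPrio : (E → E → Set₁) → (E → Set) → E → E → Set₁
  restrictPrio R C e e' = R e e' × ¬ (⪯[ C ] e' e ⊎ ⪯[ C ] e e')

-- Priorities between two events matter only when both are enabled at the same prefix of the
-- trace. Two distinct events enabled together are never ⪯_C-related: if a ≺_C b via X ↦ b,
-- then b being enabled puts some x ∈ X into the prefix; x and a both lie in the conflict-free
-- configuration, so stability forces x = a, and a is in the prefix, hence not enabled. Since
-- prefixes of a trace are ≺_C-downward closed, the same holds along a ≺_C-chain. So the pairs
-- removed from ⋖ are never consulted, and both priority relations admit the same traces.
module Submission where

open import Defs
open import Data.List using (List; _∷_; length; lookup; take)
open import Data.List.Membership.Propositional using (_∈_)
open import Data.List.Membership.Propositional.Properties using (∈-lookup)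
open import Data.List.Relation.Unary.Any using (here; there; index)
open import Data.List.Relation.Unary.Any.Properties using (lookup-index)
open import Data.Fin using (Fin; toℕ; zero; suc)
open import Data.Fin.Properties using (toℕ-injective)
open import Data.Nat using (suc; _<_; _≤_; z≤n; s≤s)
open import Data.Nat.Properties using (<-cmp; <-≤-trans; <⇒≤)
open import Data.Product using (Σ; _×_; _,_; proj₁; proj₂)
open import Data.Sum using (_⊎_; inj₁; inj₂; [_,_])
open import Function.Bundles using (_⇔_; mk⇔; Equivalence)
open import Relation.Binary.Definitions using (tri<; tri≈; tri>)
open import Relation.Binary.PropositionalEquality using (_≡_; _≢_; refl; sym)
open import Relation.Binary.Construct.Closure.ReflexiveTransitive using (Star; ε; _◅_)
open import Relation.Nullary using (¬_)

module _ {A : Set} where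

  lookup∈take : ∀ k (xs : List A) (p : Fin (length xs)) → toℕ p < k → lookup xs p ∈ take k xs
  lookup∈take (suc k) (x ∷ xs) zero    _         = here refl
  lookup∈take (suc k) (x ∷ xs) (suc p) (s≤s p<k) = there (lookup∈take k xs p p<k)

  ∈-take⇒lookup : ∀ k (xs : List A) {x} → x ∈ take k xs →
                  Σ (Fin (length xs)) λ p → toℕ p < k × lookup xs p ≡ x
  ∈-take⇒lookup (suc k) (y ∷ xs) (here refl) = zero , s≤s z≤n , refl
  ∈-take⇒lookup (suc k) (y ∷ xs) (there x∈)  =
    let p , p<k , eq = ∈-take⇒lookup k xs x∈ in suc p , s≤s p<k , eq

  ∈-take-mono : ∀ {j k} (xs : List A) {x} → j ≤ k → x ∈ take j xs → x ∈ take k xs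
  ∈-take-mono {j} {k} xs j≤k x∈ with ∈-take⇒lookup j xs x∈
  ... | p , p<j , refl = lookup∈take k xs p (<-≤-trans p<j j≤k)

  ∈-take⇒∈ : ∀ k (xs : List A) {x} → x ∈ take k xs → x ∈ xs
  ∈-take⇒∈ k xs x∈ with ∈-take⇒lookup k xs x∈
  ... | p , _ , refl = ∈-lookup p

module _ {Act : Set} (β : BES Act) where
  open BES β

  module _ {σ : List E} (tr : IsTrace β σ) where

    trace-conflictFree : ∀ {a b} → a ∈ σ → b ∈ σ → ¬ (a # b)
    trace-conflictFree a∈ b∈ a#b
      with index a∈ | lookup-index a∈ | index b∈ | lookup-index b∈
    ... | p | refl | q | refl with <-cmp (toℕ p) (toℕ q)
    ... | tri< p<q _ _ = proj₂ (proj₂ (tr q)) (_ , lookup∈take _ σ p p<q , #-sym _ _ a#b)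
    ... | tri≈ _ p≡q _ rewrite toℕ-injective p≡q = #-irrefl _ a#b
    ... | tri> _ _ q<p = proj₂ (proj₂ (tr p)) (_ , lookup∈take _ σ q q<p , a#b)

    module _ {C : E → Set} (C⊆σ : ∀ {e} → C e → e ∈ σ) where

      -- Only ¬¬ is available: E has no decidable equality, and stability yields x ≢ a → x # a.
      ≺-enabled⇒∈prefix : ∀ k {a b} → ≺[ β ] C a b → en β (take k σ) b → ¬ ¬ (a ∈ take k σ)
      ≺-enabled⇒∈prefix k {a} {b} (Ca , _ , X , Xa , X↦b) en-b a∉ with proj₁ (proj₂ en-b) X X↦b
      ... | x , Xx , x∈ =
        trace-conflictFree (C⊆σ Ca) (∈-take⇒∈ k σ x∈)
          (stability X b X↦b a x Xa Xx λ { refl → a∉ x∈ })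

      ≺-∈prefix⇒∈prefix : ∀ k {a b} → ≺[ β ] C a b → b ∈ take k σ → ¬ ¬ (a ∈ take k σ)
      ≺-∈prefix⇒∈prefix k a≺b b∈ a∉ with ∈-take⇒lookup k σ b∈
      ... | p , p<k , refl =
        ≺-enabled⇒∈prefix (toℕ p) a≺b (tr p) (λ a∈ → a∉ (∈-take-mono σ (<⇒≤ p<k) a∈))

      ⪯-enabled⇒∈prefix : ∀ k {a b} → Star (≺[ β ] C) a b → en β (take k σ) b →
                          a ≡ b ⊎ ¬ ¬ (a ∈ take k σ)
      ⪯-enabled⇒∈prefix k ε           en-b = inj₁ refl
      ⪯-enabled⇒∈prefix k (a≺c ◅ c⪯b) en-b with ⪯-enabled⇒∈prefix k c⪯b en-b
      ... | inj₁ refl = inj₂ (≺-enabled⇒∈prefix k a≺c en-b)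
      ... | inj₂ ¬¬c∈ = inj₂ λ a∉ → ¬¬c∈ λ c∈ → ≺-∈prefix⇒∈prefix k a≺c c∈ a∉

      enabled⇒¬⪯ : ∀ k {a b} → a ≢ b → en β (take k σ) a → en β (take k σ) b →
                   ¬ Star (≺[ β ] C) a b
      enabled⇒¬⪯ k a≢b en-a en-b a⪯b with ⪯-enabled⇒∈prefix k a⪯b en-b
      ... | inj₁ a≡b  = a≢b a≡b
      ... | inj₂ ¬¬a∈ = ¬¬a∈ (proj₁ en-a)

  IsPTrace-antimono : ∀ (R R' : E → E → Set₁) {σ} →
    (∀ i {a b} → a ≢ b → en β (take i σ) a → en β (take i σ) b → R a b → R' a b) →
    IsPTrace β R' σ → IsPTrace β R σ
  IsPTrace-antimono _ _ R⇒R' (tr , prio) =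
    tr , λ i i< j h j≢h en-j en-h r →
      prio i i< j h j≢h en-j en-h (R⇒R' i (λ eq → j≢h (sym eq)) en-h en-j r)

theorem4 : {Act : Set} (β : BES Act) (⋖ : BES.E β → BES.E β → Set₁) →
    Acyclic β ⋖ →
    (C : BES.E β → Set) → IsConfiguration β C →
    (σ : List (BES.E β)) →
    InTracesRestr β ⋖ C σ ⇔ InTracesRestr β (restrictPrio β ⋖ C) C σ
theorem4 β ⋖ _ C _ σ = mk⇔
  (λ (ptr , hs) → IsPTrace-antimono β ⋖' ⋖ (λ _ _ _ _ → proj₁) ptr , hs)
  (λ (ptr , hs) → IsPTrace-antimono β ⋖ ⋖' (⋖⇒⋖' (proj₁ ptr) hs) ptr , hs)
  where
  ⋖' : BES.E β → BES.E β → Set₁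
  ⋖' = restrictPrio β ⋖ C

  ⋖⇒⋖' : IsTrace β σ → HasSet β σ C →
    ∀ i {a b} → a ≢ b → en β (take i σ) a → en β (take i σ) b → ⋖ a b → ⋖' a b
  ⋖⇒⋖' tr hs i a≢b en-a en-b a⋖b = a⋖b ,
    [ (λ (_ , _ , b⪯a) → enabled⇒¬⪯ β tr (Equivalence.to (hs _)) i (λ eq → a≢b (sym eq)) en-b en-a b⪯a)
    , (λ (_ , _ , a⪯b) → enabled⇒¬⪯ β tr (Equivalence.to (hs _)) i a≢b en-a en-b a⪯b) ]
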